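{- Let $\ell\ge1$, $0\le k\le\ell$, $B=(b_1,\ldots,b_\ell)$ with integers $b_i\ge2$, and let $H_{\ell,k;B}=W_{\ell,k;B}A_{\ell,k;B}$, where $W_{\ell,k;B}=A_{\ell,k;B}^{+}$ is the Moore–Penrose pseudo-inverse of $A_{\ell,k;B}$. Then the sum of the entries of every row (and of every column) of $H_{\ell,k;B}$ equals $1$. Furthermore, for $u,w\in\Sigma_B$, with $P=\{i: w_i=u_i\}$ and $Q=\{i: w_i\ne u_i\}$, $$H_{\ell,k;B}(u,w)=\frac{1}{\prod_{i=1}^\ell b_i}\sum_{G\subseteq[\ell],\ |G|\ge\ell-k}(-1)^{|Q\setminus G|}\prod_{i\in P\setminus G}(b_i-1).$$
   Context: For an integer $b\ge2$ let $\Sigma_b=\{0,\ldots,b-1\}$ and $\Delta_b=\Sigma_b\cup\{g\}$ with $g$ a gap symbol; $\Sigma_B,\Delta_B$ are the products over $b_1,\ldots,b_\ell$, elements written as words $v_1\cdots v_\ell$. For $v\in\Delta_B$, $G_v=\{i: v_i=g\}$. $V_{\ell,k;B}=\{v\in\Delta_B:|G_v|=\ell-k\}$. $u\in\Sigma_B$ and $v\in\Delta_B$ match if $u_i=v_i$ whenever $v_i\ne g$. $A_{\ell,k;B}$ is the $(0,1)$ matrix with rows indexed by $V_{\ell,k;B}$, columns indexed by $\Sigma_B$, and entry $1$ at $(v,u)$ iff $u$ and $v$ match. Thus $H_{\ell,k;B}$ is a square matrix with rows and columns indexed by $\Sigma_B$. -}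

module Defs where

open import Data.Nat as ℕ using (ℕ; zero; suc; _≤_; _∸_; NonZero; s≤s; z≤n)
open import Data.Nat.Properties using (m*n≢0)
open import Data.Fin using (Fin; zero; suc) renaming (_≟_ to _≟ᶠ_)
open import Data.Maybe using (Maybe; just; nothing)
open import Data.Bool using (Bool; true; false; if_then_else_; _∧_; not)
open import Data.List using (List; []; _∷_; map; concatMap; foldr; allFin; filter)
open import Data.Integer using (+_)
open import Data.Rational using (ℚ; 0ℚ; 1ℚ; _+_; _*_; -_; _/_)
open import Relation.Nullary.Decidable using (⌊_⌋)
open import Relation.Binary.PropositionalEquality using (_≡_)

Word : (ℓ : ℕ) → (Fin ℓ → ℕ) → Set
Word ℓ B = (i : Fin ℓ) → Fin (B i)

-- Δ_B : words over Σ_{b_i} ∪ {g}; the gap symbol g is represented by nothing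
GWord : (ℓ : ℕ) → (Fin ℓ → ℕ) → Set
GWord ℓ B = (i : Fin ℓ) → Maybe (Fin (B i))

consW : ∀ {ℓ} {B : Fin (suc ℓ) → ℕ} {C : Fin (suc ℓ) → Set} →
        C zero → ((i : Fin ℓ) → C (suc i)) → (i : Fin (suc ℓ)) → C i
consW x w zero = x
consW x w (suc i) = w i

allWords : (ℓ : ℕ) (B : Fin ℓ → ℕ) → List (Word ℓ B)
allWords zero B = (λ ()) ∷ []
allWords (suc ℓ) B =
  concatMap (λ x → map (λ w → consW {ℓ} {B} {λ i → Fin (B i)} x w) (allWords ℓ (λ i → B (suc i))))
            (allFin (B zero))

allGWords : (ℓ : ℕ) (B : Fin ℓ → ℕ) → List (GWord ℓ B)
allGWords zero B = (λ ()) ∷ []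
allGWords (suc ℓ) B =
  concatMap (λ x → map (λ w → consW {ℓ} {B} {λ i → Maybe (Fin (B i))} x w) (allGWords ℓ (λ i → B (suc i))))
            (nothing ∷ map just (allFin (B zero)))

isGap : {A : Set} → Maybe A → Bool
isGap nothing = true
isGap (just _) = false

countB : (ℓ : ℕ) → (Fin ℓ → Bool) → ℕ
countB ℓ p = foldr (λ i n → if p i then suc n else n) zero (allFin ℓ)

numGaps : ∀ {ℓ B} → GWord ℓ B → ℕ
numGaps {ℓ} v = countB ℓ (λ i → isGap (v i))

Vlist : (ℓ k : ℕ) (B : Fin ℓ → ℕ) → List (GWord ℓ B)
Vlist ℓ k B = filter (λ v → numGaps v ℕ.≟ (ℓ ∸ k)) (allGWords ℓ B)

matchB : ∀ {ℓ B} → Word ℓ B → GWord ℓ B → Bool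
matchB {ℓ} u v = foldr (λ i b → ok (u i) (v i) ∧ b) true (allFin ℓ)
  where
  ok : ∀ {n} → Fin n → Maybe (Fin n) → Bool
  ok x nothing = true
  ok x (just y) = ⌊ x ≟ᶠ y ⌋

Amat : ∀ {ℓ B} → GWord ℓ B → Word ℓ B → ℚ
Amat v u = if matchB u v then 1ℚ else 0ℚ

sumL : {A : Set} → List A → (A → ℚ) → ℚ
sumL xs f = foldr (λ x s → f x + s) 0ℚ xs

prodL : {A : Set} → List A → (A → ℚ) → ℚ
prodL xs f = foldr (λ x s → f x * s) 1ℚ xs

ℕtoℚ : ℕ → ℚ
ℕtoℚ n = + n / 1

powℚ : ℚ → ℕ → ℚ
powℚ q zero = 1ℚ
powℚ q (suc n) = q * powℚ q n

Subset : ℕ → Set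
Subset ℓ = Fin ℓ → Bool

allSubsets : (ℓ : ℕ) → List (Subset ℓ)
allSubsets zero = (λ ()) ∷ []
allSubsets (suc ℓ) =
  concatMap (λ x → map (λ s → consW {ℓ} {λ _ → 0} {λ _ → Bool} x s) (allSubsets ℓ)) (true ∷ false ∷ [])

card : ∀ {ℓ} → Subset ℓ → ℕ
card {ℓ} G = countB ℓ G

prodB : (ℓ : ℕ) → (Fin ℓ → ℕ) → ℕ
prodB ℓ B = foldr (λ i n → B i ℕ.* n) 1 (allFin ℓ)

prodB-nonZero : (ℓ : ℕ) (B : Fin ℓ → ℕ) → (∀ i → 2 ≤ B i) → NonZero (prodB ℓ B)
prodB-nonZero ℓ B hB = go (allFin ℓ)
  where
  go : (xs : List (Fin ℓ)) → NonZero (foldr (λ i n → B i ℕ.* n) 1 xs)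
  go [] = _
  go (x ∷ xs) with B x | hB x
  ... | suc (suc c) | _ = m*n≢0 (suc (suc c)) _ {{_}} {{go xs}}
  ... | suc zero | s≤s ()
  ... | zero | ()

-- The Moore–Penrose conditions for W (rows Σ_B, columns V) being A_{ℓ,k;B}^+ ;
-- products are taken over the index sets Σ_B and V_{ℓ,k;B}.
module _ (ℓ k : ℕ) (B : Fin ℓ → ℕ) (W : Word ℓ B → GWord ℓ B → ℚ) where
  InV : GWord ℓ B → Set
  InV v = numGaps v ≡ ℓ ∸ k

  AW : GWord ℓ B → GWord ℓ B → ℚ
  AW v v' = sumL (allWords ℓ B) (λ u → Amat v u * W u v')

  WA : Word ℓ B → Word ℓ B → ℚ
  WA u u' = sumL (Vlist ℓ k B) (λ v → W u v * Amat v u')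

  record IsPseudoInverse : Set where
    field
      AWA≡A : ∀ v u → InV v → sumL (Vlist ℓ k B) (λ v' → AW v v' * Amat v' u) ≡ Amat v u
      WAW≡W : ∀ u v → InV v → sumL (allWords ℓ B) (λ u' → WA u u' * W u' v) ≡ W u v
      AW-sym : ∀ v v' → InV v → InV v' → AW v v' ≡ AW v' v
      WA-sym : ∀ u u' → WA u u' ≡ WA u' u

formulaSum : (ℓ k : ℕ) (B : Fin ℓ → ℕ) → Word ℓ B → Word ℓ B → ℚ
formulaSum ℓ k B u w =
  sumL (filter (λ G → (ℓ ∸ k) ℕ.≤? card G) (allSubsets ℓ)) λ G →
    powℚ (- 1ℚ) (countB ℓ (λ i → not ⌊ w i ≟ᶠ u i ⌋ ∧ not (G i)))
    * prodL (allFin ℓ) (λ i → if ⌊ w i ≟ᶠ u i ⌋ ∧ not (G i) then ℕtoℚ (B i ∸ 1) else 1ℚ)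

-- The rows of A span the functions on Σ_B that depend on at most k coordinates. With m = ℓ − k
-- and E = J/b the averaging projection on one coordinate, the orthogonal projection onto this
-- span factors over the first coordinate as P_{ℓ,m} = E ⊗ P_{ℓ−1,m−1} + (I − E) ⊗ P_{ℓ−1,m}.
-- Induction on ℓ shows that P is symmetric, fixes every row of A and has its rows in the row
-- space of A; the Moore–Penrose equations AWA = A and (WA)ᵀ = WA then force WA = P. The row sums
-- of P are 1 because averaging a coordinate kills the I − E part, and expanding the recursion over
-- the set G of coordinates where E is chosen gives the closed formula, since b(I − E) has diagonal
-- entries b − 1 and off-diagonal entries −1.

module Submission where

open import Data.Bool using (Bool; true; false; if_then_else_; _∧_; not)
open import Data.Empty using (⊥-elim)
open import Data.Fin using (Fin; zero; suc; _≟_)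
open import Data.Integer as ℤ using (ℤ; +_)
import Data.Integer.Tactic.RingSolver as ℤ-Ring
open import Data.List using (List; []; _∷_; _++_; map; concatMap; foldr; filter; allFin)
open import Data.List.Properties using (foldr-cong; foldr-map; map-tabulate)
open import Data.Maybe using (Maybe; just; nothing)
open import Data.Nat as ℕ using (ℕ; zero; suc; _∸_; _≤_; s≤s; z≤n; NonZero)
import Data.Nat.Properties as ℕ
open import Data.Nat.Coprimality using (1-coprimeTo; sym)
open import Data.Product using (_×_; _,_)
open import Data.Rational using (ℚ; 0ℚ; 1ℚ; _+_; _*_; -_; _-_; _/_; mkℚ; toℚᵘ)
open import Data.Rational.Properties hiding (_≟_)
open import Data.Rational.Solver using (module +-*-Solver)
open +-*-Solver
import Data.Rational.Unnormalised as ℚᵘ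
import Data.Rational.Unnormalised.Properties as ℚᵘ
open import Function using (id; _∘_)
open import Function.Bundles using (mk⇔)
open import Level using (0ℓ)
open import Relation.Nullary using (does; yes; no)
open import Relation.Nullary.Decidable using (⌊_⌋; does-⇔)
open import Relation.Unary using (Pred; Decidable)
open import Relation.Binary.PropositionalEquality hiding (sym)
import Relation.Binary.PropositionalEquality as ≡

open import Defs

-- 1/n, with the junk value 1/0 = 0 so that no NonZero instance has to be carried along
recip : ℕ → ℚ
recip zero = 0ℚ
recip (suc n) = + 1 / suc n

ℕtoℚ≡mkℚ : ∀ n → ℕtoℚ n ≡ mkℚ (+ n) 0 (sym (1-coprimeTo n))
ℕtoℚ≡mkℚ n = normalize-coprime (sym (1-coprimeTo n))

recip≡mkℚ : ∀ n → recip (suc n) ≡ mkℚ (+ 1) n (1-coprimeTo (suc n))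
recip≡mkℚ n = normalize-coprime (1-coprimeTo (suc n))

recip-*-ℕtoℚ : ∀ n → recip (suc n) * ℕtoℚ (suc n) ≡ 1ℚ
recip-*-ℕtoℚ n rewrite recip≡mkℚ n | ℕtoℚ≡mkℚ (suc n) =
  *-inverseˡ (mkℚ (+ suc n) 0 (sym (1-coprimeTo (suc n))))

recip-* : ∀ m n → recip (m ℕ.* n) ≡ recip m * recip n
recip-* zero n = ≡.sym (*-zeroˡ (recip n))
recip-* (suc m) zero rewrite ℕ.*-zeroʳ m = ≡.sym (*-zeroʳ (recip (suc m)))
recip-* (suc m) (suc n) rewrite recip≡mkℚ m | recip≡mkℚ n = refl

recip≡1/ : ∀ n → .{{_ : NonZero n}} → recip n ≡ + 1 / n
recip≡1/ (suc n) = refl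

ℕtoℚ-suc : ∀ n → ℕtoℚ (suc n) ≡ 1ℚ + ℕtoℚ n
ℕtoℚ-suc n = toℚᵘ-injective (begin
  toℚᵘ (ℕtoℚ (suc n))                   ≈⟨ toℚᵘ-cong (ℕtoℚ≡mkℚ (suc n)) ⟩
  ℚᵘ.mkℚᵘ (+ suc n) 0                   ≈⟨ ℚᵘ.*≡* (crossMultiplied (+ n)) ⟩
  ℚᵘ.1ℚᵘ ℚᵘ.+ ℚᵘ.mkℚᵘ (+ n) 0           ≈⟨ ℚᵘ.+-congʳ ℚᵘ.1ℚᵘ (toℚᵘ-cong (ℕtoℚ≡mkℚ n)) ⟨
  toℚᵘ 1ℚ ℚᵘ.+ toℚᵘ (ℕtoℚ n)            ≈⟨ toℚᵘ-homo-+ 1ℚ (ℕtoℚ n) ⟨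
  toℚᵘ (1ℚ + ℕtoℚ n)                    ∎)
  where
  open ℚᵘ.≃-Reasoning
  crossMultiplied : ∀ (i : ℤ) → (+ 1 ℤ.+ i) ℤ.* + 1 ≡ (+ 1 ℤ.* + 1 ℤ.+ i ℤ.* + 1) ℤ.* (+ 1 ℤ.* + 1)
  crossMultiplied = ℤ-Ring.solve-∀

module _ {A : Set} where

  sumL-cong : (xs : List A) {f g : A → ℚ} → (∀ x → f x ≡ g x) → sumL xs f ≡ sumL xs g
  sumL-cong xs f≗g = foldr-cong (λ x s → cong (_+ s) (f≗g x)) refl xs

  sumL-zero : (xs : List A) → sumL xs (λ _ → 0ℚ) ≡ 0ℚ
  sumL-zero [] = refl
  sumL-zero (x ∷ xs) = trans (+-identityˡ _) (sumL-zero xs)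

  sumL-+ : (xs : List A) (f g : A → ℚ) → sumL xs (λ x → f x + g x) ≡ sumL xs f + sumL xs g
  sumL-+ [] f g = refl
  sumL-+ (x ∷ xs) f g rewrite sumL-+ xs f g =
    solve 4 (λ a b c d → (a :+ b) :+ (c :+ d) := (a :+ c) :+ (b :+ d)) refl (f x) (g x) (sumL xs f) (sumL xs g)

  sumL-*ˡ : (xs : List A) (c : ℚ) (f : A → ℚ) → sumL xs (λ x → c * f x) ≡ c * sumL xs f
  sumL-*ˡ [] c f = ≡.sym (*-zeroʳ c)
  sumL-*ˡ (x ∷ xs) c f rewrite sumL-*ˡ xs c f = ≡.sym (*-distribˡ-+ c (f x) (sumL xs f))

  sumL-*ʳ : (xs : List A) (c : ℚ) (f : A → ℚ) → sumL xs (λ x → f x * c) ≡ sumL xs f * c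
  sumL-*ʳ xs c f = trans (sumL-cong xs (λ x → *-comm (f x) c)) (trans (sumL-*ˡ xs c f) (*-comm c _))

  sumL-linear : (xs : List A) (p q : ℚ) (f g : A → ℚ) →
    sumL xs (λ x → p * f x + q * g x) ≡ p * sumL xs f + q * sumL xs g
  sumL-linear xs p q f g = trans (sumL-+ xs (λ x → p * f x) (λ x → q * g x)) (cong₂ _+_ (sumL-*ˡ xs p f) (sumL-*ˡ xs q g))

  sumL-++ : (xs ys : List A) (f : A → ℚ) → sumL (xs ++ ys) f ≡ sumL xs f + sumL ys f
  sumL-++ [] ys f = ≡.sym (+-identityˡ _)
  sumL-++ (x ∷ xs) ys f rewrite sumL-++ xs ys f = ≡.sym (+-assoc (f x) (sumL xs f) (sumL ys f))

  sumL-filter : {P : Pred A 0ℓ} (P? : Decidable P) (xs : List A) (f : A → ℚ) →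
    sumL (filter P? xs) f ≡ sumL xs (λ x → if does (P? x) then f x else 0ℚ)
  sumL-filter P? [] f = refl
  sumL-filter P? (x ∷ xs) f with does (P? x)
  ... | true = cong (_+_ (f x)) (sumL-filter P? xs f)
  ... | false = trans (sumL-filter P? xs f) (≡.sym (+-identityˡ _))

  sumL-filter-cong : {P : Pred A 0ℓ} (P? : Decidable P) (xs : List A) {f g : A → ℚ} →
    (∀ x → P x → f x ≡ g x) → sumL (filter P? xs) f ≡ sumL (filter P? xs) g
  sumL-filter-cong P? [] f≗g = refl
  sumL-filter-cong P? (x ∷ xs) f≗g with P? x
  ... | yes Px = cong₂ _+_ (f≗g x Px) (sumL-filter-cong P? xs f≗g)
  ... | no _ = sumL-filter-cong P? xs f≗g

  sumL-*-pull : (xs : List A) (k l : ℚ) (f g : A → ℚ) →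
    sumL xs (λ x → k * f x * (l * g x)) ≡ k * l * sumL xs (λ x → f x * g x)
  sumL-*-pull xs k l f g = trans
    (sumL-cong xs (λ x → solve 4 (λ k f l g → k :* f :* (l :* g) := k :* l :* (f :* g)) refl k (f x) l (g x)))
    (sumL-*ˡ xs (k * l) (λ x → f x * g x))

  sumL-*-linear : (xs : List A) (c p q : ℚ) (f g h : A → ℚ) →
    sumL xs (λ x → c * f x * (p * g x + q * h x))
    ≡ c * (p * sumL xs (λ x → f x * g x) + q * sumL xs (λ x → f x * h x))
  sumL-*-linear xs c p q f g h = begin
    sumL xs (λ x → c * f x * (p * g x + q * h x))
      ≡⟨ sumL-cong xs (λ x → solve 6 (λ c f p g q h → c :* f :* (p :* g :+ q :* h) := c :* p :* (f :* g) :+ c :* q :* (f :* h))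
                                  refl c (f x) p (g x) q (h x)) ⟩
    sumL xs (λ x → c * p * (f x * g x) + c * q * (f x * h x))
      ≡⟨ sumL-linear xs (c * p) (c * q) (λ x → f x * g x) (λ x → f x * h x) ⟩
    c * p * sumL xs (λ x → f x * g x) + c * q * sumL xs (λ x → f x * h x)
      ≡⟨ solve 5 (λ c p q s t → c :* p :* s :+ c :* q :* t := c :* (p :* s :+ q :* t)) refl c p q _ _ ⟩
    c * (p * sumL xs (λ x → f x * g x) + q * sumL xs (λ x → f x * h x)) ∎
    where open ≡-Reasoning

module _ {A C : Set} where

  sumL-map : (h : A → C) (xs : List A) (f : C → ℚ) → sumL (map h xs) f ≡ sumL xs (λ x → f (h x))
  sumL-map h xs f = foldr-map (λ y s → f y + s) h 0ℚ xs

  sumL-concatMap : (g : A → List C) (xs : List A) (f : C → ℚ) →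
    sumL (concatMap g xs) f ≡ sumL xs (λ x → sumL (g x) f)
  sumL-concatMap g [] f = refl
  sumL-concatMap g (x ∷ xs) f =
    trans (sumL-++ (g x) (concatMap g xs) f) (cong (_+_ (sumL (g x) f)) (sumL-concatMap g xs f))

  sumL-swap : (xs : List A) (ys : List C) (f : A → C → ℚ) →
    sumL xs (λ x → sumL ys (f x)) ≡ sumL ys (λ y → sumL xs (λ x → f x y))
  sumL-swap [] ys f = ≡.sym (sumL-zero ys)
  sumL-swap (x ∷ xs) ys f rewrite sumL-swap xs ys f = ≡.sym (sumL-+ ys (f x) (λ y → sumL xs (λ x → f x y)))

  sumL-assoc : (xs : List A) (ys : List C) (f : A → ℚ) (g : A → C → ℚ) (h : C → ℚ) →
    sumL xs (λ x → f x * sumL ys (λ y → g x y * h y)) ≡ sumL ys (λ y → sumL xs (λ x → f x * g x y) * h y)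
  sumL-assoc xs ys f g h = begin
    sumL xs (λ x → f x * sumL ys (λ y → g x y * h y))
      ≡⟨ sumL-cong xs (λ x → ≡.sym (sumL-*ˡ ys (f x) (λ y → g x y * h y))) ⟩
    sumL xs (λ x → sumL ys (λ y → f x * (g x y * h y)))
      ≡⟨ sumL-cong xs (λ x → sumL-cong ys (λ y → ≡.sym (*-assoc (f x) (g x y) (h y)))) ⟩
    sumL xs (λ x → sumL ys (λ y → f x * g x y * h y))
      ≡⟨ sumL-swap xs ys (λ x y → f x * g x y * h y) ⟩
    sumL ys (λ y → sumL xs (λ x → f x * g x y * h y))
      ≡⟨ sumL-cong ys (λ y → sumL-*ʳ xs (h y) (λ x → f x * g x y)) ⟩
    sumL ys (λ y → sumL xs (λ x → f x * g x y) * h y) ∎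
    where open ≡-Reasoning

foldr-allFin-suc : {C : Set} (n : ℕ) (c : Fin (suc n) → C → C) (e : C) →
  foldr c e (allFin (suc n)) ≡ c zero (foldr (λ i → c (suc i)) e (allFin n))
foldr-allFin-suc n c e =
  cong (c zero) (trans (cong (foldr c e) (≡.sym (map-tabulate id suc))) (foldr-map c suc e (allFin n)))

sumL-allFin-suc : (n : ℕ) (f : Fin (suc n) → ℚ) →
  sumL (allFin (suc n)) f ≡ f zero + sumL (allFin n) (λ i → f (suc i))
sumL-allFin-suc n f = foldr-allFin-suc n (λ x s → f x + s) 0ℚ

δ : ∀ {n} → Fin n → Fin n → ℚ
δ zero zero = 1ℚ
δ zero (suc _) = 0ℚ
δ (suc _) zero = 0ℚ
δ (suc x) (suc y) = δ x y

δ-sym : ∀ {n} (x y : Fin n) → δ x y ≡ δ y x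
δ-sym zero zero = refl
δ-sym zero (suc y) = refl
δ-sym (suc x) zero = refl
δ-sym (suc x) (suc y) = δ-sym x y

δ-refl : ∀ {n} (x : Fin n) → δ x x ≡ 1ℚ
δ-refl zero = refl
δ-refl (suc x) = δ-refl x

δ-≢ : ∀ {n} {x y : Fin n} → x ≢ y → δ x y ≡ 0ℚ
δ-≢ {x = zero} {zero} x≢y = ⊥-elim (x≢y refl)
δ-≢ {x = zero} {suc y} x≢y = refl
δ-≢ {x = suc x} {zero} x≢y = refl
δ-≢ {x = suc x} {suc y} x≢y = δ-≢ (x≢y ∘ cong suc)

sumL-allFin-δ : (n : ℕ) (z : Fin n) (f : Fin n → ℚ) → sumL (allFin n) (λ x → δ x z * f x) ≡ f z
sumL-allFin-δ (suc n) zero f = begin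
  sumL (allFin (suc n)) (λ x → δ x zero * f x)     ≡⟨ sumL-allFin-suc n (λ x → δ x zero * f x) ⟩
  1ℚ * f zero + sumL (allFin n) (λ x → 0ℚ * f (suc x))
    ≡⟨ cong₂ _+_ (*-identityˡ (f zero))
                 (trans (sumL-cong (allFin n) (λ x → *-zeroˡ (f (suc x)))) (sumL-zero (allFin n))) ⟩
  f zero + 0ℚ                                      ≡⟨ +-identityʳ (f zero) ⟩
  f zero                                           ∎
  where open ≡-Reasoning
sumL-allFin-δ (suc n) (suc z) f = begin
  sumL (allFin (suc n)) (λ x → δ x (suc z) * f x)  ≡⟨ sumL-allFin-suc n (λ x → δ x (suc z) * f x) ⟩
  0ℚ * f zero + sumL (allFin n) (λ x → δ x z * f (suc x))
    ≡⟨ cong (_+ sumL (allFin n) (λ x → δ x z * f (suc x))) (*-zeroˡ (f zero)) ⟩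
  0ℚ + sumL (allFin n) (λ x → δ x z * f (suc x))   ≡⟨ +-identityˡ _ ⟩
  sumL (allFin n) (λ x → δ x z * f (suc x))        ≡⟨ sumL-allFin-δ n z (f ∘ suc) ⟩
  f (suc z)                                        ∎
  where open ≡-Reasoning

sumL-allFin-const : (n : ℕ) (c : ℚ) → sumL (allFin n) (λ _ → c) ≡ ℕtoℚ n * c
sumL-allFin-const zero c = ≡.sym (*-zeroˡ c)
sumL-allFin-const (suc n) c rewrite sumL-allFin-suc n (λ _ → c) | sumL-allFin-const n c | ℕtoℚ-suc n =
  solve 2 (λ c x → c :+ x :* c := (con 1ℚ :+ x) :* c) refl c (ℕtoℚ n)

sumL-allFin-recip : (n : ℕ) → .{{NonZero n}} → sumL (allFin n) (λ _ → recip n) ≡ 1ℚ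
sumL-allFin-recip (suc n) = begin
  sumL (allFin (suc n)) (λ _ → recip (suc n))   ≡⟨ sumL-allFin-const (suc n) (recip (suc n)) ⟩
  ℕtoℚ (suc n) * recip (suc n)                  ≡⟨ *-comm (ℕtoℚ (suc n)) (recip (suc n)) ⟩
  recip (suc n) * ℕtoℚ (suc n)                  ≡⟨ recip-*-ℕtoℚ n ⟩
  1ℚ                                            ∎
  where open ≡-Reasoning

-- Only the constant part survives, since Σₓ (δ x y − 1/n) = 0.
sumL-allFin-average : (n : ℕ) → .{{NonZero n}} → (y : Fin n) (α β : ℚ) →
  sumL (allFin n) (λ x → recip n * α + (δ x y - recip n) * β) ≡ α
sumL-allFin-average n y α β = begin
  sumL (allFin n) (λ x → recip n * α + (δ x y - recip n) * β)
    ≡⟨ sumL-cong (allFin n) (λ x → solve 4 (λ r a d b → r :* a :+ (d :- r) :* b := r :* (a :- b) :+ d :* b)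
                                      refl (recip n) α (δ x y) β) ⟩
  sumL (allFin n) (λ x → recip n * (α - β) + δ x y * β)
    ≡⟨ sumL-+ (allFin n) (λ _ → recip n * (α - β)) (λ x → δ x y * β) ⟩
  sumL (allFin n) (λ _ → recip n * (α - β)) + sumL (allFin n) (λ x → δ x y * β)
    ≡⟨ cong₂ _+_ (sumL-*ʳ (allFin n) (α - β) (λ _ → recip n)) (sumL-allFin-δ n y (λ _ → β)) ⟩
  sumL (allFin n) (λ _ → recip n) * (α - β) + β
    ≡⟨ cong (λ t → t * (α - β) + β) (sumL-allFin-recip n) ⟩
  1ℚ * (α - β) + β
    ≡⟨ solve 2 (λ a b → con 1ℚ :* (a :- b) :+ b := a) refl α β ⟩
  α ∎
  where open ≡-Reasoning

tail : ∀ {ℓ} {C : Fin (suc ℓ) → Set} → ((i : Fin (suc ℓ)) → C i) → (i : Fin ℓ) → C (suc i)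
tail u i = u (suc i)

matches : ∀ {n} → Fin n → Maybe (Fin n) → Bool
matches x nothing = true
matches x (just y) = ⌊ x ≟ y ⌋

-- matchB folds a step function that is local to its definition; it is recovered here by unification.
matchStep : ∀ {ℓ B} → Word ℓ B → GWord ℓ B → Fin ℓ → Bool → Bool
matchStep u v = stepOf (matchB u v) refl
  where
  stepOf : ∀ {ℓ} {c : Fin ℓ → Bool → Bool} (b : Bool) → b ≡ foldr c true (allFin ℓ) → Fin ℓ → Bool → Bool
  stepOf {c = c} _ _ = c

matchStep-≡ : ∀ {ℓ B} (u : Word ℓ B) (v : GWord ℓ B) i b → matchStep u v i b ≡ (matches (u i) (v i) ∧ b)
matchStep-≡ u v i b with v i
... | nothing = refl
... | just _ = refl

matchB-≡ : ∀ {ℓ B} (u : Word ℓ B) (v : GWord ℓ B) →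
  matchB u v ≡ foldr (λ i b → matches (u i) (v i) ∧ b) true (allFin ℓ)
matchB-≡ {ℓ} u v = foldr-cong (matchStep-≡ u v) refl (allFin ℓ)

Amat₁ : ∀ {n} → Maybe (Fin n) → Fin n → ℚ
Amat₁ nothing x = 1ℚ
Amat₁ (just y) x = δ x y

matchB-suc : ∀ {ℓ} {B : Fin (suc ℓ) → ℕ} (u : Word (suc ℓ) B) (v : GWord (suc ℓ) B) →
  matchB u v ≡ matches (u zero) (v zero) ∧ matchB (tail u) (tail v)
matchB-suc {ℓ} u v = begin
  matchB u v
    ≡⟨ matchB-≡ u v ⟩
  foldr (λ i b → matches (u i) (v i) ∧ b) true (allFin (suc ℓ))
    ≡⟨ foldr-allFin-suc ℓ (λ i b → matches (u i) (v i) ∧ b) true ⟩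
  matches (u zero) (v zero) ∧ foldr (λ i b → matches (u (suc i)) (v (suc i)) ∧ b) true (allFin ℓ)
    ≡⟨ cong (matches (u zero) (v zero) ∧_) (matchB-≡ (tail u) (tail v)) ⟨
  matches (u zero) (v zero) ∧ matchB (tail u) (tail v) ∎
  where open ≡-Reasoning

Amat-suc : ∀ {ℓ} {B : Fin (suc ℓ) → ℕ} (v : GWord (suc ℓ) B) (u : Word (suc ℓ) B) →
  Amat v u ≡ Amat₁ (v zero) (u zero) * Amat (tail v) (tail u)
Amat-suc v u rewrite matchB-suc u v with v zero
... | nothing = ≡.sym (*-identityˡ _)
... | just y with u zero ≟ y
...   | yes refl rewrite δ-refl y = ≡.sym (*-identityˡ _)
...   | no x≢y rewrite δ-≢ x≢y = ≡.sym (*-zeroˡ (Amat (tail v) (tail u)))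

module _ {ℓ : ℕ} {B : Fin (suc ℓ) → ℕ} where

  infixr 5 _∷ʷ_ _∷ᵍ_

  _∷ʷ_ : Fin (B zero) → Word ℓ (tail B) → Word (suc ℓ) B
  _∷ʷ_ = consW {ℓ} {B} {λ i → Fin (B i)}

  _∷ᵍ_ : Maybe (Fin (B zero)) → GWord ℓ (tail B) → GWord (suc ℓ) B
  _∷ᵍ_ = consW {ℓ} {B} {λ i → Maybe (Fin (B i))}

  sumL-allWords-suc : (f : Word (suc ℓ) B → ℚ) →
    sumL (allWords (suc ℓ) B) f ≡ sumL (allFin (B zero)) (λ x → sumL (allWords ℓ (tail B)) (λ w → f (x ∷ʷ w)))
  sumL-allWords-suc f = trans (sumL-concatMap _ (allFin (B zero)) f)
    (sumL-cong (allFin (B zero)) (λ x → sumL-map (x ∷ʷ_) (allWords ℓ (tail B)) f))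

gap : ∀ {n} → Maybe (Fin n) → ℕ
gap nothing = 1
gap (just _) = 0

numGaps-suc : ∀ {ℓ} {B : Fin (suc ℓ) → ℕ} (v : GWord (suc ℓ) B) → numGaps v ≡ gap (v zero) ℕ.+ numGaps (tail v)
numGaps-suc {ℓ} v = trans (foldr-allFin-suc ℓ (λ i n → if isGap (v i) then suc n else n) zero) (countGap (v zero) _)
  where
  countGap : ∀ {n} (x : Maybe (Fin n)) (c : ℕ) → (if isGap x then suc c else c) ≡ gap x ℕ.+ c
  countGap nothing c = refl
  countGap (just _) c = refl

-- V_{ℓ,k;B} is Vgaps ℓ (ℓ ∸ k) B.
Vgaps : (ℓ m : ℕ) (B : Fin ℓ → ℕ) → List (GWord ℓ B)
Vgaps ℓ m B = filter (λ v → numGaps v ℕ.≟ m) (allGWords ℓ B)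

module _ {ℓ : ℕ} {B : Fin (suc ℓ) → ℕ} (f : GWord (suc ℓ) B → ℚ) where

  sumLeadingGap : ℕ → ℚ
  sumLeadingGap zero = 0ℚ
  sumLeadingGap (suc m) = sumL (Vgaps ℓ m (tail B)) (λ v → f (nothing ∷ᵍ v))

  private
    withGaps : ℕ → GWord (suc ℓ) B → ℚ
    withGaps m v = if does (numGaps v ℕ.≟ m) then f v else 0ℚ

    withGaps-∷ : ∀ m x v → withGaps m (x ∷ᵍ v) ≡ (if does (gap x ℕ.+ numGaps v ℕ.≟ m) then f (x ∷ᵍ v) else 0ℚ)
    withGaps-∷ m x v = cong (λ n → if does (n ℕ.≟ m) then f (x ∷ᵍ v) else 0ℚ) (numGaps-suc {B = B} (x ∷ᵍ v))

    sumL-leadingGap : ∀ m → sumL (allGWords ℓ (tail B)) (λ v → withGaps m (nothing ∷ᵍ v)) ≡ sumLeadingGap m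
    sumL-leadingGap m = trans (sumL-cong (allGWords ℓ (tail B)) (withGaps-∷ m nothing)) (leadingGap m)
      where
      leadingGap : ∀ m → sumL (allGWords ℓ (tail B)) (λ v → if does (suc (numGaps v) ℕ.≟ m) then f (nothing ∷ᵍ v) else 0ℚ)
                       ≡ sumLeadingGap m
      leadingGap zero = sumL-zero (allGWords ℓ (tail B))
      leadingGap (suc m) = ≡.sym (sumL-filter (λ v → numGaps v ℕ.≟ m) (allGWords ℓ (tail B)) (λ v → f (nothing ∷ᵍ v)))

    sumL-leadingLetter : ∀ m z → sumL (allGWords ℓ (tail B)) (λ v → withGaps m (just z ∷ᵍ v))
                               ≡ sumL (Vgaps ℓ m (tail B)) (λ v → f (just z ∷ᵍ v))
    sumL-leadingLetter m z = trans (sumL-cong (allGWords ℓ (tail B)) (withGaps-∷ m (just z)))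
      (≡.sym (sumL-filter (λ v → numGaps v ℕ.≟ m) (allGWords ℓ (tail B)) (λ v → f (just z ∷ᵍ v))))

  sumL-Vgaps-suc : ∀ m → sumL (Vgaps (suc ℓ) m B) f
                 ≡ sumLeadingGap m + sumL (allFin (B zero)) (λ z → sumL (Vgaps ℓ m (tail B)) (λ v → f (just z ∷ᵍ v)))
  sumL-Vgaps-suc m = begin
    sumL (Vgaps (suc ℓ) m B) f
      ≡⟨ sumL-filter (λ v → numGaps v ℕ.≟ m) (allGWords (suc ℓ) B) f ⟩
    sumL (allGWords (suc ℓ) B) F
      ≡⟨ sumL-concatMap (λ x → map (x ∷ᵍ_) (allGWords ℓ (tail B))) (nothing ∷ map just (allFin (B zero))) F ⟩
    sumL (map (nothing ∷ᵍ_) (allGWords ℓ (tail B))) F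
      + sumL (map just (allFin (B zero))) (λ x → sumL (map (x ∷ᵍ_) (allGWords ℓ (tail B))) F)
      ≡⟨ cong₂ _+_ (sumL-map (nothing ∷ᵍ_) (allGWords ℓ (tail B)) F)
                   (trans (sumL-map just (allFin (B zero)) (λ x → sumL (map (x ∷ᵍ_) (allGWords ℓ (tail B))) F))
                          (sumL-cong (allFin (B zero)) (λ z → sumL-map (just z ∷ᵍ_) (allGWords ℓ (tail B)) F))) ⟩
    sumL (allGWords ℓ (tail B)) (λ v → F (nothing ∷ᵍ v))
      + sumL (allFin (B zero)) (λ z → sumL (allGWords ℓ (tail B)) (λ v → F (just z ∷ᵍ v)))
      ≡⟨ cong₂ _+_ (sumL-leadingGap m) (sumL-cong (allFin (B zero)) (sumL-leadingLetter m)) ⟩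
    sumLeadingGap m + sumL (allFin (B zero)) (λ z → sumL (Vgaps ℓ m (tail B)) (λ v → f (just z ∷ᵍ v))) ∎
    where
    open ≡-Reasoning
    F = withGaps m

-- The projection

-- P_{ℓ,m} of the header, with E x y = 1/b and (I − E) x y = δ x y − 1/b.
projector : (ℓ m : ℕ) (B : Fin ℓ → ℕ) → Word ℓ B → Word ℓ B → ℚ
projector zero zero B u w = 1ℚ
projector zero (suc m) B u w = 0ℚ
projector (suc ℓ) m B u w =
  recip (B zero) * projector ℓ (m ∸ 1) (tail B) (tail u) (tail w)
  + (δ (u zero) (w zero) - recip (B zero)) * projector ℓ m (tail B) (tail u) (tail w)

projector-sym : ∀ ℓ m B (u w : Word ℓ B) → projector ℓ m B u w ≡ projector ℓ m B w u
projector-sym zero zero B u w = refl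
projector-sym zero (suc m) B u w = refl
projector-sym (suc ℓ) m B u w
  rewrite projector-sym ℓ (m ∸ 1) (tail B) (tail u) (tail w)
        | projector-sym ℓ m (tail B) (tail u) (tail w)
        | δ-sym (u zero) (w zero) = refl

sumL-projector : ∀ ℓ m (B : Fin ℓ → ℕ) → (∀ i → NonZero (B i)) → m ≤ ℓ → (u : Word ℓ B) →
  sumL (allWords ℓ B) (projector ℓ m B u) ≡ 1ℚ
sumL-projector zero zero B B≢0 m≤ℓ u = refl
sumL-projector (suc ℓ) m B B≢0 m≤ℓ u = begin
  sumL (allWords (suc ℓ) B) (projector (suc ℓ) m B u)
    ≡⟨ sumL-allWords-suc (projector (suc ℓ) m B u) ⟩
  sumL (allFin b) (λ x → sumL (allWords ℓ (tail B)) (λ w → r * P₋ w + (δ (u zero) x - r) * P w))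
    ≡⟨ sumL-cong (allFin b) (λ x → sumL-linear (allWords ℓ (tail B)) r (δ (u zero) x - r) P₋ P) ⟩
  sumL (allFin b) (λ x → r * ρ₋ + (δ (u zero) x - r) * ρ)
    ≡⟨ sumL-cong (allFin b) (λ x → cong (λ d → r * ρ₋ + (d - r) * ρ) (δ-sym (u zero) x)) ⟩
  sumL (allFin b) (λ x → r * ρ₋ + (δ x (u zero) - r) * ρ)
    ≡⟨ sumL-allFin-average b {{B≢0 zero}} (u zero) ρ₋ ρ ⟩
  ρ₋
    ≡⟨ sumL-projector ℓ (m ∸ 1) (tail B) (B≢0 ∘ suc) (ℕ.∸-monoˡ-≤ 1 m≤ℓ) (tail u) ⟩
  1ℚ ∎
  where
  open ≡-Reasoning
  b = B zero
  r = recip b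
  P₋ = projector ℓ (m ∸ 1) (tail B) (tail u)
  P = projector ℓ m (tail B) (tail u)
  ρ₋ = sumL (allWords ℓ (tail B)) P₋
  ρ = sumL (allWords ℓ (tail B)) P

sumL-Amat-projector : ∀ ℓ m (B : Fin ℓ → ℕ) → (∀ i → NonZero (B i)) → (v : GWord ℓ B) → m ≤ numGaps v →
  (u : Word ℓ B) → sumL (allWords ℓ B) (λ w → Amat v w * projector ℓ m B w u) ≡ Amat v u
sumL-Amat-projector zero zero B B≢0 v m≤gaps u = refl
sumL-Amat-projector (suc ℓ) m B B≢0 v m≤gaps u = begin
  sumL (allWords (suc ℓ) B) (λ w → Amat v w * projector (suc ℓ) m B w u)
    ≡⟨ sumL-allWords-suc (λ w → Amat v w * projector (suc ℓ) m B w u) ⟩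
  sumL (allFin b) (λ x → sumL (allWords ℓ (tail B)) (λ w → Amat v (x ∷ʷ w) * projector (suc ℓ) m B (x ∷ʷ w) u))
    ≡⟨ sumL-cong (allFin b) (λ x → trans
         (sumL-cong (allWords ℓ (tail B)) (λ w → cong (_* projector (suc ℓ) m B (x ∷ʷ w) u) (Amat-suc v (x ∷ʷ w))))
         (sumL-*-linear (allWords ℓ (tail B)) (Amat₁ (v zero) x) r (δ x (u zero) - r) (Amat (tail v)) P₋ P)) ⟩
  sumL (allFin b) (λ x → Amat₁ (v zero) x * (r * α₋ + (δ x (u zero) - r) * α))
    ≡⟨ headCase (v zero) (subst (m ≤_) (numGaps-suc v) m≤gaps) ⟩
  Amat₁ (v zero) (u zero) * Amat (tail v) (tail u)
    ≡⟨ Amat-suc v u ⟨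
  Amat v u ∎
  where
  open ≡-Reasoning
  b = B zero
  r = recip b
  P₋ = λ w → projector ℓ (m ∸ 1) (tail B) w (tail u)
  P = λ w → projector ℓ m (tail B) w (tail u)
  α₋ = sumL (allWords ℓ (tail B)) (λ w → Amat (tail v) w * P₋ w)
  α = sumL (allWords ℓ (tail B)) (λ w → Amat (tail v) w * P w)
  IH : ∀ m → m ≤ numGaps (tail v) → sumL (allWords ℓ (tail B)) (λ w → Amat (tail v) w * projector ℓ m (tail B) w (tail u))
                                    ≡ Amat (tail v) (tail u)
  IH m = λ m≤ → sumL-Amat-projector ℓ m (tail B) (B≢0 ∘ suc) (tail v) m≤ (tail u)
  headCase : (y : Maybe (Fin b)) → m ≤ gap y ℕ.+ numGaps (tail v) →
    sumL (allFin b) (λ x → Amat₁ y x * (r * α₋ + (δ x (u zero) - r) * α)) ≡ Amat₁ y (u zero) * Amat (tail v) (tail u)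
  headCase nothing m≤ = begin
    sumL (allFin b) (λ x → 1ℚ * (r * α₋ + (δ x (u zero) - r) * α))
      ≡⟨ sumL-cong (allFin b) (λ x → *-identityˡ (r * α₋ + (δ x (u zero) - r) * α)) ⟩
    sumL (allFin b) (λ x → r * α₋ + (δ x (u zero) - r) * α)
      ≡⟨ sumL-allFin-average b {{B≢0 zero}} (u zero) α₋ α ⟩
    α₋
      ≡⟨ IH (m ∸ 1) (ℕ.∸-monoˡ-≤ 1 m≤) ⟩
    Amat (tail v) (tail u)
      ≡⟨ *-identityˡ _ ⟨
    1ℚ * Amat (tail v) (tail u) ∎
  headCase (just z) m≤ = begin
    sumL (allFin b) (λ x → δ x z * (r * α₋ + (δ x (u zero) - r) * α))
      ≡⟨ sumL-allFin-δ b z (λ x → r * α₋ + (δ x (u zero) - r) * α) ⟩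
    r * α₋ + (δ z (u zero) - r) * α
      ≡⟨ cong₂ (λ s t → r * s + (δ z (u zero) - r) * t) (IH (m ∸ 1) (ℕ.≤-trans (ℕ.m∸n≤m m 1) m≤)) (IH m m≤) ⟩
    r * a + (δ z (u zero) - r) * a
      ≡⟨ solve 3 (λ r d a → r :* a :+ (d :- r) :* a := d :* a) refl r (δ z (u zero)) a ⟩
    δ z (u zero) * a
      ≡⟨ cong (_* a) (δ-sym z (u zero)) ⟩
    δ (u zero) z * a ∎
    where a = Amat (tail v) (tail u)

headCoeff : ∀ {b} → ℕ → Fin b → Maybe (Fin b) → ℚ
headCoeff {b} m x nothing = recip b
headCoeff zero x (just z) = δ x z
headCoeff {b} (suc m) x (just z) = δ x z - recip b

-- Row u of the projector as a combination of the rows of A with m gaps: the E-part of the first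
-- coordinate uses a gap there, the (I − E)-part a letter; with no gap left (m = 0) both merge into δ.
projectorCoeff : (ℓ m : ℕ) (B : Fin ℓ → ℕ) → Word ℓ B → GWord ℓ B → ℚ
projectorCoeff zero m B u v = 1ℚ
projectorCoeff (suc ℓ) m B u v =
  headCoeff m (u zero) (v zero) * projectorCoeff ℓ (m ∸ gap (v zero)) (tail B) (tail u) (tail v)

sumL-projectorCoeff-Amat : ∀ ℓ m (B : Fin ℓ → ℕ) (u w : Word ℓ B) →
  sumL (Vgaps ℓ m B) (λ v → projectorCoeff ℓ m B u v * Amat v w) ≡ projector ℓ m B u w
sumL-projectorCoeff-Amat zero zero B u w = refl
sumL-projectorCoeff-Amat zero (suc m) B u w = refl
sumL-projectorCoeff-Amat (suc ℓ) m B u w = begin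
  sumL (Vgaps (suc ℓ) m B) F
    ≡⟨ sumL-Vgaps-suc F m ⟩
  sumLeadingGap F m + sumL (allFin b) (λ z → sumL (V m) (λ v → F (just z ∷ᵍ v)))
    ≡⟨ cong (_+_ (sumLeadingGap F m)) (sumL-cong (allFin b) leadingLetter) ⟩
  sumLeadingGap F m + sumL (allFin b) (λ z → δ z (w zero) * (c m z * P m))
    ≡⟨ cong (_+_ (sumLeadingGap F m)) (sumL-allFin-δ b (w zero) (λ z → c m z * P m)) ⟩
  sumLeadingGap F m + c m (w zero) * P m
    ≡⟨ combine m ⟩
  projector (suc ℓ) m B u w ∎
  where
  open ≡-Reasoning
  b = B zero
  F : GWord (suc ℓ) B → ℚ
  F v = projectorCoeff (suc ℓ) m B u v * Amat v w
  V : ℕ → List (GWord ℓ (tail B))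
  V m = Vgaps ℓ m (tail B)
  X : ℕ → GWord ℓ (tail B) → ℚ
  X m = projectorCoeff ℓ m (tail B) (tail u)
  a : GWord ℓ (tail B) → ℚ
  a v = Amat v (tail w)
  c : ℕ → Fin b → ℚ
  c m z = headCoeff m (u zero) (just z)
  P : ℕ → ℚ
  P m = projector ℓ m (tail B) (tail u) (tail w)
  IH : ∀ m → sumL (V m) (λ v → X m v * a v) ≡ P m
  IH m = sumL-projectorCoeff-Amat ℓ m (tail B) (tail u) (tail w)
  leadingLetter : ∀ z → sumL (V m) (λ v → F (just z ∷ᵍ v)) ≡ δ z (w zero) * (c m z * P m)
  leadingLetter z = begin
    sumL (V m) (λ v → F (just z ∷ᵍ v))
      ≡⟨ sumL-cong (V m) (λ v → cong (c m z * X m v *_) (Amat-suc (just z ∷ᵍ v) w)) ⟩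
    sumL (V m) (λ v → c m z * X m v * (δ (w zero) z * a v))
      ≡⟨ sumL-*-pull (V m) (c m z) (δ (w zero) z) (X m) a ⟩
    c m z * δ (w zero) z * sumL (V m) (λ v → X m v * a v)
      ≡⟨ cong₂ (λ d s → c m z * d * s) (δ-sym (w zero) z) (IH m) ⟩
    c m z * δ z (w zero) * P m
      ≡⟨ solve 3 (λ c d p → c :* d :* p := d :* (c :* p)) refl (c m z) (δ z (w zero)) (P m) ⟩
    δ z (w zero) * (c m z * P m) ∎
  combine : ∀ m → sumLeadingGap (λ v → projectorCoeff (suc ℓ) m B u v * Amat v w) m + c m (w zero) * P m
                ≡ projector (suc ℓ) m B u w
  combine zero =
    solve 3 (λ d r p → con 0ℚ :+ d :* p := r :* p :+ (d :- r) :* p) refl (δ (u zero) (w zero)) (recip b) (P 0)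
  combine (suc m) = cong (_+ c (suc m) (w zero) * P (suc m)) (begin
    sumL (V m) (λ v → recip b * X m v * Amat (nothing ∷ᵍ v) w)
      ≡⟨ sumL-cong (V m) (λ v → cong (recip b * X m v *_) (Amat-suc (nothing ∷ᵍ v) w)) ⟩
    sumL (V m) (λ v → recip b * X m v * (1ℚ * a v))
      ≡⟨ sumL-*-pull (V m) (recip b) 1ℚ (X m) a ⟩
    recip b * 1ℚ * sumL (V m) (λ v → X m v * a v)
      ≡⟨ cong₂ _*_ (*-identityʳ (recip b)) (IH m) ⟩
    recip b * P m ∎)

-- The closed formula

countB-suc : ∀ ℓ (p : Fin (suc ℓ) → Bool) →
  countB (suc ℓ) p ≡ (if p zero then suc (countB ℓ (tail p)) else countB ℓ (tail p))
countB-suc ℓ p = foldr-allFin-suc ℓ (λ i n → if p i then suc n else n) zero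

prodL-allFin-suc : ∀ ℓ (f : Fin (suc ℓ) → ℚ) → prodL (allFin (suc ℓ)) f ≡ f zero * prodL (allFin ℓ) (tail f)
prodL-allFin-suc ℓ f = foldr-allFin-suc ℓ (λ i s → f i * s) 1ℚ

prodB-suc : ∀ ℓ (B : Fin (suc ℓ) → ℕ) → prodB (suc ℓ) B ≡ B zero ℕ.* prodB ℓ (tail B)
prodB-suc ℓ B = foldr-allFin-suc ℓ (λ i n → B i ℕ.* n) 1

formulaTerm : (ℓ : ℕ) (B : Fin ℓ → ℕ) → Word ℓ B → Word ℓ B → Subset ℓ → ℚ
formulaTerm ℓ B u w G =
  powℚ (- 1ℚ) (countB ℓ (λ i → not ⌊ w i ≟ u i ⌋ ∧ not (G i)))
  * prodL (allFin ℓ) (λ i → if ⌊ w i ≟ u i ⌋ ∧ not (G i) then ℕtoℚ (B i ∸ 1) else 1ℚ)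

-- formulaSum ℓ k B is formulaSumFrom ℓ (ℓ ∸ k) B.
formulaSumFrom : (ℓ m : ℕ) (B : Fin ℓ → ℕ) → Word ℓ B → Word ℓ B → ℚ
formulaSumFrom ℓ m B u w = sumL (filter (λ G → m ℕ.≤? card G) (allSubsets ℓ)) (formulaTerm ℓ B u w)

headFactor : ∀ {b} → Fin b → Fin b → ℚ
headFactor {b} x y = if ⌊ y ≟ x ⌋ then ℕtoℚ (b ∸ 1) else - 1ℚ

infixr 5 _∷ˢ_

_∷ˢ_ : ∀ {ℓ} → Bool → Subset ℓ → Subset (suc ℓ)
_∷ˢ_ {ℓ} = consW {ℓ} {λ _ → 0} {λ _ → Bool}

module _ {ℓ : ℕ} {B : Fin (suc ℓ) → ℕ} (u w : Word (suc ℓ) B) where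

  private
    sign : Subset ℓ → ℚ
    sign G = powℚ (- 1ℚ) (countB ℓ (λ i → not ⌊ w (suc i) ≟ u (suc i) ⌋ ∧ not (G i)))

    weight : Subset ℓ → ℚ
    weight G = prodL (allFin ℓ) (λ i → if ⌊ w (suc i) ≟ u (suc i) ⌋ ∧ not (G i) then ℕtoℚ (B (suc i) ∸ 1) else 1ℚ)

  formulaTerm-gap : ∀ G → formulaTerm (suc ℓ) B u w (true ∷ˢ G) ≡ formulaTerm ℓ (tail B) (tail u) (tail w) G
  formulaTerm-gap G
    rewrite countB-suc ℓ (λ i → not ⌊ w i ≟ u i ⌋ ∧ not ((true ∷ˢ G) i))
          | prodL-allFin-suc ℓ (λ i → if ⌊ w i ≟ u i ⌋ ∧ not ((true ∷ˢ G) i) then ℕtoℚ (B i ∸ 1) else 1ℚ)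
    with ⌊ w zero ≟ u zero ⌋
  ... | true = cong (sign G *_) (*-identityˡ (weight G))
  ... | false = cong (sign G *_) (*-identityˡ (weight G))

  formulaTerm-noGap : ∀ G → formulaTerm (suc ℓ) B u w (false ∷ˢ G)
                          ≡ headFactor (u zero) (w zero) * formulaTerm ℓ (tail B) (tail u) (tail w) G
  formulaTerm-noGap G
    rewrite countB-suc ℓ (λ i → not ⌊ w i ≟ u i ⌋ ∧ not ((false ∷ˢ G) i))
          | prodL-allFin-suc ℓ (λ i → if ⌊ w i ≟ u i ⌋ ∧ not ((false ∷ˢ G) i) then ℕtoℚ (B i ∸ 1) else 1ℚ)
    with ⌊ w zero ≟ u zero ⌋
  ... | true = solve 3 (λ s c p → s :* (c :* p) := c :* (s :* p)) refl (sign G) (ℕtoℚ (B zero ∸ 1)) (weight G)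
  ... | false = solve 2 (λ s p → con (- 1ℚ) :* s :* (con 1ℚ :* p) := con (- 1ℚ) :* (s :* p)) refl (sign G) (weight G)

≤?-suc : ∀ m n → does (m ℕ.≤? suc n) ≡ does (m ∸ 1 ℕ.≤? n)
≤?-suc zero n = refl
≤?-suc (suc m) n = does-⇔ (mk⇔ ℕ.s≤s⁻¹ s≤s) (suc m ℕ.≤? suc n) (m ℕ.≤? n)

if-*ʳ : ∀ (b : Bool) (c x : ℚ) → (if b then c * x else 0ℚ) ≡ c * (if b then x else 0ℚ)
if-*ʳ true c x = refl
if-*ʳ false c x = ≡.sym (*-zeroʳ c)

formulaSumFrom-suc : ∀ ℓ m (B : Fin (suc ℓ) → ℕ) (u w : Word (suc ℓ) B) →
  formulaSumFrom (suc ℓ) m B u w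
  ≡ formulaSumFrom ℓ (m ∸ 1) (tail B) (tail u) (tail w)
    + headFactor (u zero) (w zero) * formulaSumFrom ℓ m (tail B) (tail u) (tail w)
formulaSumFrom-suc ℓ m B u w = begin
  formulaSumFrom (suc ℓ) m B u w
    ≡⟨ sumL-filter (λ G → m ℕ.≤? card G) (allSubsets (suc ℓ)) T ⟩
  sumL (allSubsets (suc ℓ)) (restrict m T)
    ≡⟨ sumL-concatMap (λ x → map (x ∷ˢ_) (allSubsets ℓ)) (true ∷ false ∷ []) (restrict m T) ⟩
  sumL (map (true ∷ˢ_) (allSubsets ℓ)) (restrict m T)
    + (sumL (map (false ∷ˢ_) (allSubsets ℓ)) (restrict m T) + 0ℚ)
    ≡⟨ cong₂ (λ s t → s + (t + 0ℚ)) (sumL-map (true ∷ˢ_) (allSubsets ℓ) (restrict m T))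
                                    (sumL-map (false ∷ˢ_) (allSubsets ℓ) (restrict m T)) ⟩
  sumL (allSubsets ℓ) (λ G → restrict m T (true ∷ˢ G))
    + (sumL (allSubsets ℓ) (λ G → restrict m T (false ∷ˢ G)) + 0ℚ)
    ≡⟨ cong₂ _+_ (sumL-cong (allSubsets ℓ) gapHead)
                 (trans (+-identityʳ _)
                        (trans (sumL-cong (allSubsets ℓ) noGapHead) (sumL-*ˡ (allSubsets ℓ) c (restrict m T₁)))) ⟩
  sumL (allSubsets ℓ) (restrict (m ∸ 1) T₁) + c * sumL (allSubsets ℓ) (restrict m T₁)
    ≡⟨ cong₂ (λ s t → s + c * t) (sumL-filter (λ G → m ∸ 1 ℕ.≤? card G) (allSubsets ℓ) T₁)
                                 (sumL-filter (λ G → m ℕ.≤? card G) (allSubsets ℓ) T₁) ⟨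
  formulaSumFrom ℓ (m ∸ 1) (tail B) (tail u) (tail w) + c * formulaSumFrom ℓ m (tail B) (tail u) (tail w) ∎
  where
  open ≡-Reasoning
  T = formulaTerm (suc ℓ) B u w
  T₁ = formulaTerm ℓ (tail B) (tail u) (tail w)
  c = headFactor (u zero) (w zero)
  restrict : ∀ {n} → ℕ → (Subset n → ℚ) → Subset n → ℚ
  restrict m f G = if does (m ℕ.≤? card G) then f G else 0ℚ
  gapHead : ∀ G → restrict m T (true ∷ˢ G) ≡ restrict (m ∸ 1) T₁ G
  gapHead G = begin
    restrict m T (true ∷ˢ G)
      ≡⟨ cong (λ n → if does (m ℕ.≤? n) then T (true ∷ˢ G) else 0ℚ) (countB-suc ℓ (true ∷ˢ G)) ⟩
    (if does (m ℕ.≤? suc (card G)) then T (true ∷ˢ G) else 0ℚ)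
      ≡⟨ cong₂ (λ b t → if b then t else 0ℚ) (≤?-suc m (card G)) (formulaTerm-gap u w G) ⟩
    restrict (m ∸ 1) T₁ G ∎
  noGapHead : ∀ G → restrict m T (false ∷ˢ G) ≡ c * restrict m T₁ G
  noGapHead G = begin
    restrict m T (false ∷ˢ G)
      ≡⟨ cong (λ t → if does (m ℕ.≤? card (false ∷ˢ G)) then t else 0ℚ) (formulaTerm-noGap u w G) ⟩
    (if does (m ℕ.≤? card (false ∷ˢ G)) then c * T₁ G else 0ℚ)
      ≡⟨ cong (λ n → if does (m ℕ.≤? n) then c * T₁ G else 0ℚ) (countB-suc ℓ (false ∷ˢ G)) ⟩
    (if does (m ℕ.≤? card G) then c * T₁ G else 0ℚ)
      ≡⟨ if-*ʳ (does (m ℕ.≤? card G)) c (T₁ G) ⟩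
    c * restrict m T₁ G ∎

recip-*-headFactor : ∀ {b} → .{{NonZero b}} → (x y : Fin b) → recip b * headFactor x y ≡ δ x y - recip b
recip-*-headFactor {suc b} x y with y ≟ x
... | yes refl rewrite δ-refl y = begin
  recip (suc b) * ℕtoℚ b
    ≡⟨ solve 2 (λ r n → r :* n := r :* (con 1ℚ :+ n) :- r) refl (recip (suc b)) (ℕtoℚ b) ⟩
  recip (suc b) * (1ℚ + ℕtoℚ b) - recip (suc b)
    ≡⟨ cong (λ n → recip (suc b) * n - recip (suc b)) (ℕtoℚ-suc b) ⟨
  recip (suc b) * ℕtoℚ (suc b) - recip (suc b)
    ≡⟨ cong (_- recip (suc b)) (recip-*-ℕtoℚ b) ⟩
  1ℚ - recip (suc b) ∎
  where open ≡-Reasoning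
... | no y≢x rewrite δ-≢ (y≢x ∘ ≡.sym) = solve 1 (λ r → r :* con (- 1ℚ) := con 0ℚ :- r) refl (recip (suc b))

recip-prodB-*-formulaSumFrom : ∀ ℓ m (B : Fin ℓ → ℕ) → (∀ i → NonZero (B i)) → (u w : Word ℓ B) →
  recip (prodB ℓ B) * formulaSumFrom ℓ m B u w ≡ projector ℓ m B u w
recip-prodB-*-formulaSumFrom zero zero B B≢0 u w = refl
recip-prodB-*-formulaSumFrom zero (suc m) B B≢0 u w = refl
recip-prodB-*-formulaSumFrom (suc ℓ) m B B≢0 u w = begin
  recip (prodB (suc ℓ) B) * formulaSumFrom (suc ℓ) m B u w
    ≡⟨ cong₂ _*_ (trans (cong recip (prodB-suc ℓ B)) (recip-* b (prodB ℓ (tail B)))) (formulaSumFrom-suc ℓ m B u w) ⟩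
  r * r′ * (F₋ + c * F)
    ≡⟨ solve 5 (λ r r′ f c g → r :* r′ :* (f :+ c :* g) := r :* (r′ :* f) :+ r :* c :* (r′ :* g)) refl r r′ F₋ c F ⟩
  r * (r′ * F₋) + r * c * (r′ * F)
    ≡⟨ cong₂ (λ s t → r * s + r * c * t) (IH (m ∸ 1)) (IH m) ⟩
  r * P (m ∸ 1) + r * c * P m
    ≡⟨ cong (λ t → r * P (m ∸ 1) + t * P m) (recip-*-headFactor {{B≢0 zero}} (u zero) (w zero)) ⟩
  projector (suc ℓ) m B u w ∎
  where
  open ≡-Reasoning
  b = B zero
  r = recip b
  r′ = recip (prodB ℓ (tail B))
  c = headFactor (u zero) (w zero)
  F₋ = formulaSumFrom ℓ (m ∸ 1) (tail B) (tail u) (tail w)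
  F = formulaSumFrom ℓ m (tail B) (tail u) (tail w)
  P : ℕ → ℚ
  P m = projector ℓ m (tail B) (tail u) (tail w)
  IH : ∀ m → r′ * formulaSumFrom ℓ m (tail B) (tail u) (tail w) ≡ P m
  IH m = recip-prodB-*-formulaSumFrom ℓ m (tail B) (B≢0 ∘ suc) (tail u) (tail w)

module _ (ℓ k : ℕ) (B : Fin ℓ → ℕ) (W : Word ℓ B → GWord ℓ B → ℚ) (pinv : IsPseudoInverse ℓ k B W) where

  open IsPseudoInverse pinv using (AWA≡A; WA-sym)

  private
    S = allWords ℓ B
    V = Vlist ℓ k B
    H = WA ℓ k B W
    V? = λ (v : GWord ℓ B) → numGaps v ℕ.≟ (ℓ ∸ k)

    Amat-WA : ∀ v → numGaps v ≡ ℓ ∸ k → ∀ w → sumL S (λ w′ → Amat v w′ * H w′ w) ≡ Amat v w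
    Amat-WA v v∈V w = trans (sumL-assoc S V (Amat v) W (λ v′ → Amat v′ w)) (AWA≡A v w v∈V)

  WA≡projection : (K : Word ℓ B → Word ℓ B → ℚ) (X : Word ℓ B → GWord ℓ B → ℚ) →
    (∀ u w → K u w ≡ K w u) →
    (∀ v → numGaps v ≡ ℓ ∸ k → ∀ u → sumL S (λ w → Amat v w * K w u) ≡ Amat v u) →
    (∀ u w → sumL V (λ v → X u v * Amat v w) ≡ K u w) →
    ∀ u w → H u w ≡ K u w
  WA≡projection K X K-sym Amat-K X-Amat u w = begin
    H u w                                   ≡⟨ WA-sym u w ⟩
    H w u                                   ≡⟨ WA-K w u ⟨
    sumL S (λ w′ → H w w′ * K w′ u)
      ≡⟨ sumL-cong S (λ w′ → trans (*-comm (H w w′) (K w′ u)) (cong₂ _*_ (K-sym w′ u) (WA-sym w w′))) ⟩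
    sumL S (λ w′ → K u w′ * H w′ w)         ≡⟨ K-WA u w ⟩
    K u w                                   ∎
    where
    open ≡-Reasoning
    WA-K : ∀ u w → sumL S (λ w′ → H u w′ * K w′ w) ≡ H u w
    WA-K u w = begin
      sumL S (λ w′ → H u w′ * K w′ w)                    ≡⟨ sumL-assoc V S (W u) Amat (λ w′ → K w′ w) ⟨
      sumL V (λ v → W u v * sumL S (λ w′ → Amat v w′ * K w′ w))
        ≡⟨ sumL-filter-cong V? (allGWords ℓ B) (λ v v∈V → cong (W u v *_) (Amat-K v v∈V w)) ⟩
      H u w                                              ∎
    K-WA : ∀ u w → sumL S (λ w′ → K u w′ * H w′ w) ≡ K u w
    K-WA u w = begin
      sumL S (λ w′ → K u w′ * H w′ w)                    ≡⟨ sumL-cong S (λ w′ → cong (_* H w′ w) (X-Amat u w′)) ⟨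
      sumL S (λ w′ → sumL V (λ v → X u v * Amat v w′) * H w′ w)
                                                         ≡⟨ sumL-assoc V S (X u) Amat (λ w′ → H w′ w) ⟨
      sumL V (λ v → X u v * sumL S (λ w′ → Amat v w′ * H w′ w))
        ≡⟨ sumL-filter-cong V? (allGWords ℓ B) (λ v v∈V → cong (X u v *_) (Amat-WA v v∈V w)) ⟩
      sumL V (λ v → X u v * Amat v w)                    ≡⟨ X-Amat u w ⟩
      K u w                                              ∎

theorem4 : (ℓ k : ℕ) → 1 ≤ ℓ → k ≤ ℓ → (B : Fin ℓ → ℕ) → (hB : ∀ i → 2 ≤ B i) →
    (W : Word ℓ B → GWord ℓ B → ℚ) → IsPseudoInverse ℓ k B W →
    (∀ u → sumL (allWords ℓ B) (λ w → WA ℓ k B W u w) ≡ 1ℚ)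
    × (∀ w → sumL (allWords ℓ B) (λ u → WA ℓ k B W u w) ≡ 1ℚ)
    × (∀ u w → WA ℓ k B W u w
         ≡ (_/_ (+ 1) (prodB ℓ B) {{prodB-nonZero ℓ B hB}}) * formulaSum ℓ k B u w)
theorem4 ℓ k _ _ B hB W pinv = rowSums , columnSums , entries
  where
  open IsPseudoInverse pinv using (WA-sym)
  m = ℓ ∸ k
  B≢0 : ∀ i → NonZero (B i)
  B≢0 i = ℕ.>-nonZero (ℕ.<-trans (s≤s z≤n) (hB i))
  WA≡projector : ∀ u w → WA ℓ k B W u w ≡ projector ℓ m B u w
  WA≡projector = WA≡projection ℓ k B W pinv (projector ℓ m B) (projectorCoeff ℓ m B) (projector-sym ℓ m B)
    (λ v v∈V → sumL-Amat-projector ℓ m B B≢0 v (ℕ.≤-reflexive (≡.sym v∈V)))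
    (sumL-projectorCoeff-Amat ℓ m B)
  rowSums : ∀ u → sumL (allWords ℓ B) (WA ℓ k B W u) ≡ 1ℚ
  rowSums u = trans (sumL-cong (allWords ℓ B) (WA≡projector u)) (sumL-projector ℓ m B B≢0 (ℕ.m∸n≤m ℓ k) u)
  columnSums : ∀ w → sumL (allWords ℓ B) (λ u → WA ℓ k B W u w) ≡ 1ℚ
  columnSums w = trans (sumL-cong (allWords ℓ B) (λ u → WA-sym u w)) (rowSums w)
  entries : ∀ u w → WA ℓ k B W u w ≡ (_/_ (+ 1) (prodB ℓ B) {{prodB-nonZero ℓ B hB}}) * formulaSum ℓ k B u w
  entries u w = begin
    WA ℓ k B W u w                                       ≡⟨ WA≡projector u w ⟩
    projector ℓ m B u w                                  ≡⟨ recip-prodB-*-formulaSumFrom ℓ m B B≢0 u w ⟨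
    recip (prodB ℓ B) * formulaSumFrom ℓ m B u w
      ≡⟨ cong (_* formulaSum ℓ k B u w) (recip≡1/ (prodB ℓ B) {{prodB-nonZero ℓ B hB}}) ⟩
    (_/_ (+ 1) (prodB ℓ B) {{prodB-nonZero ℓ B hB}}) * formulaSum ℓ k B u w ∎
    where open ≡-Reasoning
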